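{- Let $X$ be a discrete generalized ordered set and $Y$ any generalized ordered set. Then for all $(x,y),(x',y')\in X\times Y$, $(x,y)<(x',y')$ in the lexicographic order if and only if $(x,y)<_w(x',y')$ in the weak lexicographic order.
   Context: The setting is constructive mathematics: no use of the law of excluded middle. For a set with a binary relation $<$, write $x\leq_{P}y$ if for all $z$, $z<x$ implies $z<y$, and $y<z$ implies $x<z$. A generalized ordered set is a set with a binary relation $<$ that is asymmetric ($x<y$ implies $\neg(y<x)$), transitive ($x<y<z$ implies $x<z$) and positively antisymmetric ($x\leq_{P}y$ and $y\leq_{P}x$ imply $x=y$). $X$ is discrete if for all $x,y\in X$, $x<y$ or $x=y$ or $y<x$. The lexicographic order is: $(x,y)<(x',y')$ iff $x<x'$, or ($x=x'$ and $y<y'$). The weak lexicographic order is: $(x,y)<_w(x',y')$ iff (1) $x\leq_{P}x'$ in $X$; (2) $x=x'$ implies $y<y'$; and (3) $\neg(x=x')$ implies $x<x'$. -}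

module Defs where

open import Level using (Level; _⊔_; suc)
open import Data.Product using (_×_; _,_)
open import Data.Sum using (_⊎_)
open import Relation.Nullary using (¬_)
open import Relation.Binary.PropositionalEquality using (_≡_)

_≤P⟨_⟩_ : ∀ {a ℓ} {A : Set a} → A → (A → A → Set ℓ) → A → Set (a ⊔ ℓ)
x ≤P⟨ _<_ ⟩ y = ∀ z → (z < x → z < y) × (y < z → x < z)

record GenOrdSet (a ℓ : Level) : Set (Level.suc (a ⊔ ℓ)) where
  field
    Carrier : Set a
    _<_     : Carrier → Carrier → Set ℓ
    asym    : ∀ {x y} → x < y → ¬ (y < x)
    trans   : ∀ {x y z} → x < y → y < z → x < z
    posAntisym : ∀ {x y} → x ≤P⟨ _<_ ⟩ y → y ≤P⟨ _<_ ⟩ x → x ≡ y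

  _≤P_ : Carrier → Carrier → Set (a ⊔ ℓ)
  x ≤P y = x ≤P⟨ _<_ ⟩ y

open GenOrdSet public using (Carrier)

Discrete : ∀ {a ℓ} → GenOrdSet a ℓ → Set (a ⊔ ℓ)
Discrete X = ∀ x y → (x < y) ⊎ ((x ≡ y) ⊎ (y < x))
  where open GenOrdSet X

LexLt : ∀ {a ℓ b m} (X : GenOrdSet a ℓ) (Y : GenOrdSet b m) →
        Carrier X × Carrier Y → Carrier X × Carrier Y → Set (a ⊔ ℓ ⊔ m)
LexLt X Y (x , y) (x' , y') =
  GenOrdSet._<_ X x x' ⊎ ((x ≡ x') × GenOrdSet._<_ Y y y')

WLexLt : ∀ {a ℓ b m} (X : GenOrdSet a ℓ) (Y : GenOrdSet b m) →
         Carrier X × Carrier Y → Carrier X × Carrier Y → Set (a ⊔ ℓ ⊔ m)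
WLexLt X Y (x , y) (x' , y') =
  GenOrdSet._≤P_ X x x'
  × ((x ≡ x' → GenOrdSet._<_ Y y y')
  × (¬ (x ≡ x') → GenOrdSet._<_ X x x'))

module Submission where

open import Defs
open import Data.Product using (_×_; _,_; proj₂)
open import Data.Sum using (inj₁; inj₂)
open import Data.Empty using (⊥-elim)
open import Relation.Nullary using (¬_)
open import Relation.Binary.PropositionalEquality using (_≡_; refl)
open import Function.Base using (id)
open import Function.Bundles using (_⇔_; mk⇔)

module _ {a ℓ} (X : GenOrdSet a ℓ) where
  open GenOrdSet X

  <-irrefl : ∀ {x} → ¬ (x < x)
  <-irrefl x<x = asym x<x x<x

  ≤P-refl : ∀ {x} → x ≤P x
  ≤P-refl z = id , id

  <⇒≤P : ∀ {x y} → x < y → x ≤P y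
  <⇒≤P x<y z = (λ z<x → trans z<x x<y) , (λ y<z → trans x<y y<z)

  ≤P⇒≯ : ∀ {x y} → x ≤P y → ¬ (y < x)
  ≤P⇒≯ {x} x≤y y<x = <-irrefl (proj₂ (x≤y x) y<x)

module _ {a ℓ b m} (X : GenOrdSet a ℓ) (Y : GenOrdSet b m) where
  private
    module X = GenOrdSet X
    module Y = GenOrdSet Y

  LexLt⇒WLexLt : ∀ p q → LexLt X Y p q → WLexLt X Y p q
  LexLt⇒WLexLt _ _ (inj₁ x<x') =
    <⇒≤P X x<x' , (λ { refl → ⊥-elim (<-irrefl X x<x') }) , (λ _ → x<x')
  LexLt⇒WLexLt _ _ (inj₂ (refl , y<y')) =
    ≤P-refl X , (λ _ → y<y') , (λ x≢x → ⊥-elim (x≢x refl))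

  -- Trichotomy is only needed here: ≤P rules out x' < x, leaving x < x' or x = x'.
  WLexLt⇒LexLt : Discrete X → ∀ p q → WLexLt X Y p q → LexLt X Y p q
  WLexLt⇒LexLt discrete (x , _) (x' , _) (x≤x' , y<y' , _) with discrete x x'
  ... | inj₁ x<x'        = inj₁ x<x'
  ... | inj₂ (inj₁ x≡x') = inj₂ (x≡x' , y<y' x≡x')
  ... | inj₂ (inj₂ x'<x) = ⊥-elim (≤P⇒≯ X x≤x' x'<x)

theorem28 : ∀ {a ℓ b m} (X : GenOrdSet a ℓ) (Y : GenOrdSet b m) →
    Discrete X →
    (p q : Carrier X × Carrier Y) → LexLt X Y p q ⇔ WLexLt X Y p q
theorem28 X Y discrete p q =
  mk⇔ (LexLt⇒WLexLt X Y p q) (WLexLt⇒LexLt X Y discrete p q)
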